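{- Let $d \geqslant 2$ and $k \geqslant 2$ be integers, let $\eta > 0$, and let $G$ be a finite $d$-regular graph together with integers $f_1(d), \ldots, f_k(d)$ satisfying $1 \leqslant f_i(d) \leqslant \frac{\eta d}{k \log d}$ and $|S(x,i) \cap \Gamma(y)| \leqslant f_i(d)$ for all $i \in \{1,\ldots,k\}$, all $x \in V(G)$ and all $y \in V(G) \setminus B(x,i-1)$. Let $x \in V(G)$. Then there is a partition $S(x,k) = B_1 \cup \cdots \cup B_m$ into $m \leqslant d\big(f_{k-1}(d) + f_k(d)\big) + 1$ sets such that any two distinct $y,z$ in the same $B_j$ satisfy $d(y,z) \geqslant 3$.
   Context: $\Gamma(u)$ is the neighbourhood of $u$, $d(\cdot,\cdot)$ graph distance, $S(u,i) = \{v : d(u,v) = i\}$, $B(u,i) = \{v : d(u,v) \leqslant i\}$; $\log$ is the natural logarithm. -}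

module Defs where

open import Data.Nat using (ℕ; zero; suc; _≤_; _<_)
open import Data.Fin using (Fin)
open import Data.List using (List; length; filter)
open import Data.List.Base using ()
open import Data.Fin.Base using ()
open import Data.Product using (Σ; _×_)
open import Data.Empty using (⊥)
open import Relation.Nullary using (¬_)
open import Relation.Binary using (Decidable)
open import Relation.Binary.PropositionalEquality using (_≡_; _≢_)
open import Function.Definitions using (Injective)

record Graph (n : ℕ) : Set₁ where
  field
    Adj    : Fin n → Fin n → Set
    adj?   : Decidable Adj
    sym    : ∀ {u v} → Adj u v → Adj v u
    irrefl : ∀ {u} → ¬ Adj u u

module _ {n : ℕ} (G : Graph n) where
  open Graph G

  neighbours : Fin n → List (Fin n)
  neighbours v = filter (adj? v) (Data.List.allFin n)

  degree : Fin n → ℕ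
  degree v = length (neighbours v)

  Regular : ℕ → Set
  Regular d = ∀ v → degree v ≡ d

  data Walk : Fin n → Fin n → ℕ → Set where
    here : ∀ {u} → Walk u u 0
    step : ∀ {u w v ℓ} → Adj u w → Walk w v ℓ → Walk u v (suc ℓ)

  Ball : Fin n → ℕ → Fin n → Set
  Ball u i v = Σ ℕ λ ℓ → ℓ ≤ i × Walk u v ℓ

  Sphere : Fin n → ℕ → Fin n → Set
  Sphere u i v = Ball u i v × (∀ j → j < i → ¬ Ball u j v)

  DistGe3 : Fin n → Fin n → Set
  DistGe3 u v = ¬ Ball u 2 v

AtMost : {n : ℕ} → ℕ → (Fin n → Set) → Set
AtMost {n} f A = ∀ (m : ℕ) (g : Fin m → Fin n) → Injective _≡_ _≡_ g → (∀ i → A (g i)) → m ≤ f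

{-# OPTIONS --safe #-}
-- Colour S(x,k) greedily in vertex order, each vertex y avoiding the colours of the earlier
-- vertices of S(x,k) within distance 2 of y; it then suffices to count those vertices.  Let t of
-- the d neighbours of y lie in B(x,k-1): 1 ≤ t ≤ f(k-1), and each of them has at most d
-- neighbours in S(x,k), whereas y and its other d - t neighbours lie outside B(x,k-1) and so
-- have at most f(k) each.  This gives at most f(k) + t d + (d - t) f(k) ≤ d (f(k-1) + f(k)).
module Submission where

open import Defs
open import Data.Nat using (ℕ; zero; suc; _+_; _*_; _∸_; _≤_; _<_; z≤n; s≤s; _≟_; _<?_)
open import Data.Nat.Properties
open import Data.Fin as F using (Fin; toℕ)
open import Data.Fin.Properties as FinP using (¬∀⟶∃¬; pigeonhole; toℕ<n; toℕ-injective; any?)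
open import Data.List using (List; []; _∷_; _++_; length; filter; map; take; concatMap; lookup; allFin)
open import Data.List.Properties using (length-++; length-map; length-filter; length-take; take-all)
open import Data.List.Membership.Propositional using (_∈_; _∉_)
open import Data.List.Membership.Propositional.Properties
  using (∈-++⁺ˡ; ∈-++⁺ʳ; ∈-concatMap⁺; ∈-map⁺; ∈-filter⁺; ∈-filter⁻; ∈-allFin; ∈-lookup; ∈-length)
open import Data.List.Relation.Unary.Any using (index)
import Data.List.Relation.Unary.Any as Any
open import Data.List.Relation.Unary.Any.Properties using (lookup-index)
import Data.List.Relation.Unary.All as All
open import Data.List.Relation.Unary.AllPairs using (_∷_)
open import Data.List.Relation.Unary.Unique.Propositional using (Unique)
open import Data.List.Relation.Unary.Unique.Propositional.Properties using (filter⁺; allFin⁺)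
open import Data.Product using (Σ; ∃; _×_; _,_; proj₁; proj₂)
open import Data.Empty using (⊥-elim)
open import Data.Sum using (_⊎_; inj₁; inj₂; [_,_])
open import Function using (_∘_)
open import Level using (0ℓ)
open import Relation.Nullary using (¬_; Dec; yes; no; contradiction)
open import Relation.Nullary.Decidable using (_×-dec_)
open import Relation.Unary using (Pred; Decidable)
open import Relation.Binary using (Rel; Symmetric; tri<; tri≈; tri>)
open import Relation.Binary.PropositionalEquality
  using (_≡_; _≢_; refl; sym; cong; subst; ≢-sym; module ≡-Reasoning)
open import Function.Definitions using (Injective)
open import Algebra.Properties.CommutativeSemigroup +-commutativeSemigroup
  using (interchange; x∙yz≈y∙xz)

∃∉ : ∀ {m} (xs : List (Fin m)) → length xs < m → ∃ (_∉ xs)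
∃∉ {m} xs len = ¬∀⟶∃¬ m (_∈ xs) (λ i → Any.any? (i FinP.≟_) xs) all∈⇒⊥
  where
  all∈⇒⊥ : ¬ (∀ i → i ∈ xs)
  all∈⇒⊥ all∈ with pigeonhole len (λ i → index (all∈ i))
  ... | i , j , i<j , same-index = FinP.<⇒≢ i<j (begin
    i                          ≡⟨ lookup-index (all∈ i) ⟩
    lookup xs (index (all∈ i)) ≡⟨ cong (lookup xs) same-index ⟩
    lookup xs (index (all∈ j)) ≡⟨ lookup-index (all∈ j) ⟨
    j                          ∎)
    where open ≡-Reasoning

lookup-injective : ∀ {A : Set} {xs : List A} → Unique xs → Injective _≡_ _≡_ (lookup xs)
lookup-injective (_ ∷ _)         {F.zero}  {F.zero}  _  = refl
lookup-injective (x∉xs ∷ _)      {F.zero}  {F.suc j} eq = ⊥-elim (All.lookup x∉xs (∈-lookup j) eq)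
lookup-injective (x∉xs ∷ _)      {F.suc i} {F.zero}  eq = ⊥-elim (All.lookup x∉xs (∈-lookup i) (sym eq))
lookup-injective (_ ∷ xs-unique) {F.suc i} {F.suc j} eq = cong F.suc (lookup-injective xs-unique eq)

AtMost⇒length≤ : ∀ {n f} {A : Fin n → Set} {xs : List (Fin n)} →
  AtMost f A → Unique xs → (∀ {z} → z ∈ xs → A z) → length xs ≤ f
AtMost⇒length≤ {xs = xs} atMost unique all∈A =
  atMost (length xs) (lookup xs) (lookup-injective unique) (λ i → all∈A (∈-lookup i))

-- Moving t * b to the left avoids the truncated subtraction in (length xs ∸ t) * b.
length-concatMap-split : ∀ {A B : Set} {P : Pred A 0ℓ} (P? : Decidable P) (h : A → List B) {a b : ℕ} →
  (∀ w → P w → length (h w) ≤ a) → (∀ w → ¬ P w → length (h w) ≤ b) → ∀ xs →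
  length (concatMap h xs) + length (filter P? xs) * b ≤ length (filter P? xs) * a + length xs * b
length-concatMap-split P? h ha hb [] = z≤n
length-concatMap-split P? h {a} {b} ha hb (w ∷ xs) with P? w
... | yes Pw = begin
  length (h w ++ concatMap h xs) + (b + t * b) ≡⟨ cong (_+ (b + t * b)) (length-++ (h w)) ⟩
  (hw + rest) + (b + t * b)                   ≡⟨ interchange hw rest b (t * b) ⟩
  (hw + b) + (rest + t * b)                   ≤⟨ +-mono-≤ (+-monoˡ-≤ b (ha w Pw)) (length-concatMap-split P? h ha hb xs) ⟩
  (a + b) + (t * a + length xs * b)           ≡⟨ interchange a b (t * a) (length xs * b) ⟩
  (a + t * a) + (b + length xs * b)           ∎
  where
  open ≤-Reasoning
  hw rest t : ℕ
  hw = length (h w)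
  rest = length (concatMap h xs)
  t = length (filter P? xs)
... | no ¬Pw = begin
  length (h w ++ concatMap h xs) + t * b      ≡⟨ cong (_+ t * b) (length-++ (h w)) ⟩
  (hw + rest) + t * b                         ≡⟨ +-assoc hw rest (t * b) ⟩
  hw + (rest + t * b)                         ≤⟨ +-mono-≤ (hb w ¬Pw) (length-concatMap-split P? h ha hb xs) ⟩
  b + (t * a + length xs * b)                 ≡⟨ x∙yz≈y∙xz b (t * a) (length xs * b) ⟩
  t * a + (b + length xs * b)                 ∎
  where
  open ≤-Reasoning
  hw rest t : ℕ
  hw = length (h w)
  rest = length (concatMap h xs)
  t = length (filter P? xs)

module GreedyColouring {n : ℕ} (D : ℕ) (conflicts : Fin n → List (Fin n)) where

  Colouring : Set
  Colouring = Fin n → Fin (suc D)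

  earlier : Fin n → List (Fin n)
  earlier y = filter (λ z → toℕ z <? toℕ y) (conflicts y)

  -- Truncating to D colours makes recolouring total; it changes nothing at the vertices with at
  -- most D conflicts, which are the only ones the colouring has to get right.
  forbidden : Colouring → Fin n → List (Fin (suc D))
  forbidden c y = take D (map c (earlier y))

  forbidden-short : ∀ c y → length (forbidden c y) < suc D
  forbidden-short c y = s≤s (≤-trans (≤-reflexive (length-take D _)) (m⊓n≤m D _))

  recolour : Colouring → Fin n → Fin (suc D)
  recolour c y = proj₁ (∃∉ (forbidden c y) (forbidden-short c y))

  recolour-∉ : ∀ c y → recolour c y ∉ forbidden c y
  recolour-∉ c y = proj₂ (∃∉ (forbidden c y) (forbidden-short c y))

  update : Colouring → ℕ → Colouring
  update c j y with toℕ y ≟ j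
  ... | yes _ = recolour c y
  ... | no _  = c y

  stage : ℕ → Colouring
  stage zero    _ = F.zero
  stage (suc j)   = update (stage j) j

  stage-settled : ∀ {y} j → toℕ y < j → stage j y ≡ recolour (stage (toℕ y)) y
  stage-settled {y} (suc j) y<1+j with toℕ y ≟ j
  ... | yes y≡j = cong (λ i → recolour (stage i) y) (sym y≡j)
  ... | no  y≢j = stage-settled j (≤∧≢⇒< (≤-pred y<1+j) y≢j)

  colouring : Colouring
  colouring = stage n

  colouring-avoids-earlier : ∀ {y z} → length (conflicts y) ≤ D → z ∈ conflicts y → toℕ z < toℕ y →
    colouring y ≢ colouring z
  colouring-avoids-earlier {y} {z} few z∈ z<y same =
    recolour-∉ c y (subst (_∈ forbidden c y) (sym cy≡cz) cz∈)
    where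
    c : Colouring
    c = stage (toℕ y)
    cy≡cz : recolour c y ≡ c z
    cy≡cz = begin
      recolour c y                 ≡⟨ stage-settled n (toℕ<n y) ⟨
      colouring y                  ≡⟨ same ⟩
      colouring z                  ≡⟨ stage-settled n (toℕ<n z) ⟩
      recolour (stage (toℕ z)) z   ≡⟨ stage-settled (toℕ y) z<y ⟨
      c z                          ∎
      where open ≡-Reasoning
    forbidden-whole : forbidden c y ≡ map c (earlier y)
    forbidden-whole = take-all D _ (begin
      length (map c (earlier y)) ≡⟨ length-map c (earlier y) ⟩
      length (earlier y)         ≤⟨ length-filter _ (conflicts y) ⟩
      length (conflicts y)       ≤⟨ few ⟩
      D                          ∎)
      where open ≤-Reasoning
    cz∈ : c z ∈ forbidden c y
    cz∈ = subst (c z ∈_) (sym forbidden-whole) (∈-map⁺ c (∈-filter⁺ _ z∈ z<y))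

  colouring-proper : {P : Pred (Fin n) 0ℓ} {R : Rel (Fin n) 0ℓ} → Symmetric R →
    (∀ {y} → P y → length (conflicts y) ≤ D) →
    (∀ {y z} → P z → R y z → y ≢ z → z ∈ conflicts y) →
    ∀ {y z} → P y → P z → y ≢ z → R y z → colouring y ≢ colouring z
  colouring-proper R-sym few conflict {y} {z} Py Pz y≢z Ryz with <-cmp (toℕ y) (toℕ z)
  ... | tri< y<z _ _ = λ same →
    colouring-avoids-earlier (few Pz) (conflict Py (R-sym Ryz) (≢-sym y≢z)) y<z (sym same)
  ... | tri≈ _ y≡z _ = contradiction (toℕ-injective y≡z) y≢z
  ... | tri> _ _ z<y = colouring-avoids-earlier (few Py) (conflict Pz Ryz y≢z) z<y

module _ {n : ℕ} (G : Graph n) where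
  open Graph G using (Adj; adj?) renaming (sym to Adj-sym)

  walk? : ∀ u v ℓ → Dec (Walk G u v ℓ)
  walk? u v zero with u FinP.≟ v
  ... | yes refl = yes here
  ... | no  u≢v  = no λ { here → u≢v refl }
  walk? u v (suc ℓ) with any? (λ w → adj? u w ×-dec walk? w v ℓ)
  ... | yes (w , a , p) = yes (step a p)
  ... | no  ¬walk       = no λ { (step a p) → ¬walk (_ , a , p) }

  Ball-mono : ∀ {u v i j} → i ≤ j → Ball G u i v → Ball G u j v
  Ball-mono i≤j (ℓ , ℓ≤i , p) = ℓ , ≤-trans ℓ≤i i≤j , p

  Ball-suc⁻ : ∀ {u v i} → Ball G u (suc i) v → Ball G u i v ⊎ Walk G u v (suc i)
  Ball-suc⁻ (ℓ , ℓ≤1+i , p) with m≤n⇒m<n∨m≡n ℓ≤1+i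
  ... | inj₁ ℓ<1+i = inj₁ (ℓ , ≤-pred ℓ<1+i , p)
  ... | inj₂ refl  = inj₂ p

  ball? : ∀ u i v → Dec (Ball G u i v)
  ball? u zero v with walk? u v zero
  ... | yes p  = yes (0 , z≤n , p)
  ... | no  ¬p = no λ { (.0 , z≤n , p) → ¬p p }
  ball? u (suc i) v with ball? u i v | walk? u v (suc i)
  ... | yes b  | _      = yes (Ball-mono (n≤1+n i) b)
  ... | no  _  | yes p  = yes (suc i , ≤-refl , p)
  ... | no  ¬b | no  ¬p = no ([ ¬b , ¬p ] ∘ Ball-suc⁻)

  sphere? : ∀ u i v → Dec (Sphere G u i v)
  sphere? u zero v with ball? u zero v
  ... | yes b  = yes (b , λ _ ())
  ... | no  ¬b = no (¬b ∘ proj₁)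
  sphere? u (suc i) v with ball? u (suc i) v | ball? u i v
  ... | no  ¬b | _      = no (¬b ∘ proj₁)
  ... | yes _  | yes bi = no λ s → proj₂ s i ≤-refl bi
  ... | yes b  | no ¬bi = yes (b , λ j j<1+i bj → ¬bi (Ball-mono (≤-pred j<1+i) bj))

  snoc : ∀ {u w v ℓ} → Walk G u w ℓ → Adj w v → Walk G u v (suc ℓ)
  snoc here       a = step a here
  snoc (step b p) a = step b (snoc p a)

  reverse : ∀ {u v ℓ} → Walk G u v ℓ → Walk G v u ℓ
  reverse here       = here
  reverse (step a p) = snoc (reverse p) (Adj-sym a)

  Ball-sym : ∀ {u v i} → Ball G u i v → Ball G v i u
  Ball-sym (ℓ , ℓ≤i , p) = ℓ , ℓ≤i , reverse p

  Ball-step : ∀ {u w v i} → Ball G u i w → Adj w v → Ball G u (suc i) v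
  Ball-step (ℓ , ℓ≤i , p) a = suc ℓ , s≤s ℓ≤i , snoc p a

  Sphere-predecessor : ∀ {x y i} → Sphere G x (suc i) y → ∃ λ w → Adj y w × Ball G x i w
  Sphere-predecessor ((zero , _ , p) , outside) = contradiction (0 , z≤n , p) (outside 0 (s≤s z≤n))
  Sphere-predecessor ((suc ℓ , 1+ℓ≤1+i , p) , _) with reverse p
  ... | step a q = _ , a , ℓ , ≤-pred 1+ℓ≤1+i , reverse q

  Sphere-inner-neighbour : ∀ {x y w i} → Sphere G x (suc i) y → Adj y w → Ball G x i w → Sphere G x i w
  Sphere-inner-neighbour (_ , outside) a b =
    b , λ j j<i bj → outside (suc j) (s≤s j<i) (Ball-step bj (Adj-sym a))

  ∈-neighbours⁺ : ∀ {u v} → Adj u v → v ∈ neighbours G u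
  ∈-neighbours⁺ {u} {v} a = ∈-filter⁺ (adj? u) (∈-allFin v) a

  ∈-neighbours⁻ : ∀ {u v} → v ∈ neighbours G u → Adj u v
  ∈-neighbours⁻ {u} v∈ = proj₂ (∈-filter⁻ (adj? u) {xs = allFin n} v∈)

  neighbours-unique : ∀ u → Unique (neighbours G u)
  neighbours-unique u = filter⁺ (adj? u) (allFin⁺ n)

module Conflicts {n : ℕ} (G : Graph n) {d : ℕ} (regular : Regular G d) (x : Fin n) (i : ℕ) {F₀ F₁ : ℕ}
  (inner-bound : ∀ y → ¬ Ball G x (i ∸ 1) y → AtMost F₀ (λ w → Sphere G x i w × Graph.Adj G y w))
  (outer-bound : ∀ y → ¬ Ball G x i y → AtMost F₁ (λ w → Sphere G x (suc i) w × Graph.Adj G y w))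
  where

  Layer : Pred (Fin n) 0ℓ
  Layer = Sphere G x (suc i)

  neighboursInLayer : Fin n → List (Fin n)
  neighboursInLayer w = filter (sphere? G x (suc i)) (neighbours G w)

  conflicts : Fin n → List (Fin n)
  conflicts y = neighboursInLayer y ++ concatMap neighboursInLayer (neighbours G y)

  near⇒conflict : ∀ {y z} → Layer z → Ball G y 2 z → y ≢ z → z ∈ conflicts y
  near⇒conflict _ (_ , _ , here) y≢z = contradiction refl y≢z
  near⇒conflict z∈L (_ , _ , step a here) _ = ∈-++⁺ˡ (∈-filter⁺ _ (∈-neighbours⁺ G a) z∈L)
  near⇒conflict {y} z∈L (_ , _ , step a (step b here)) _ =
    ∈-++⁺ʳ (neighboursInLayer y)
      (∈-concatMap⁺ neighboursInLayer
        (Any.map (λ { refl → ∈-filter⁺ _ (∈-neighbours⁺ G b) z∈L }) (∈-neighbours⁺ G a)))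
  near⇒conflict _ (_ , s≤s (s≤s ()) , step _ (step _ (step _ _))) _

  neighboursInLayer-≤-degree : ∀ w → length (neighboursInLayer w) ≤ d
  neighboursInLayer-≤-degree w = ≤-trans (length-filter _ (neighbours G w)) (≤-reflexive (regular w))

  neighboursInLayer-≤-F₁ : ∀ w → ¬ Ball G x i w → length (neighboursInLayer w) ≤ F₁
  neighboursInLayer-≤-F₁ w w∉B = AtMost⇒length≤ (outer-bound w w∉B)
    (filter⁺ _ (neighbours-unique G w))
    (λ z∈ → let z∈Γ , z∈L = ∈-filter⁻ _ {xs = neighbours G w} z∈ in z∈L , ∈-neighbours⁻ G z∈Γ)

  inner : Fin n → List (Fin n)
  inner y = filter (ball? G x i) (neighbours G y)

  inner-≤-F₀ : ∀ {y} → Layer y → length (inner y) ≤ F₀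
  inner-≤-F₀ {y} y∈L@(_ , outside) = AtMost⇒length≤ (inner-bound y (outside (i ∸ 1) (s≤s (m∸n≤m i 1))))
    (filter⁺ _ (neighbours-unique G y))
    (λ w∈ → let w∈Γ , w∈B = ∈-filter⁻ _ {xs = neighbours G y} w∈
                a = ∈-neighbours⁻ G w∈Γ
            in Sphere-inner-neighbour G y∈L a w∈B , a)

  inner-nonempty : ∀ {y} → Layer y → 1 ≤ length (inner y)
  inner-nonempty y∈L with Sphere-predecessor G y∈L
  ... | w , a , w∈B = ∈-length (∈-filter⁺ _ (∈-neighbours⁺ G a) w∈B)

  conflicts-length : ∀ {y} → Layer y → length (conflicts y) ≤ d * (F₀ + F₁)
  conflicts-length {y} y∈L@(_ , outside) = begin
    length (conflicts y)                  ≡⟨ length-++ (neighboursInLayer y) ⟩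
    length (neighboursInLayer y) + c      ≤⟨ +-monoˡ-≤ c (neighboursInLayer-≤-F₁ y (outside i ≤-refl)) ⟩
    F₁ + c                                ≤⟨ +-monoˡ-≤ c F₁≤t*F₁ ⟩
    t * F₁ + c                            ≡⟨ +-comm (t * F₁) c ⟩
    c + t * F₁                            ≤⟨ split ⟩
    t * d + length (neighbours G y) * F₁  ≡⟨ cong (λ m → t * d + m * F₁) (regular y) ⟩
    t * d + d * F₁                        ≤⟨ +-monoˡ-≤ (d * F₁) (*-monoˡ-≤ d (inner-≤-F₀ y∈L)) ⟩
    F₀ * d + d * F₁                       ≡⟨ cong (_+ d * F₁) (*-comm F₀ d) ⟩
    d * F₀ + d * F₁                       ≡⟨ *-distribˡ-+ d F₀ F₁ ⟨
    d * (F₀ + F₁)                         ∎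
    where
    open ≤-Reasoning
    t c : ℕ
    t = length (inner y)
    c = length (concatMap neighboursInLayer (neighbours G y))
    F₁≤t*F₁ : F₁ ≤ t * F₁
    F₁≤t*F₁ = ≤-trans (≤-reflexive (sym (*-identityˡ F₁))) (*-monoˡ-≤ F₁ (inner-nonempty y∈L))
    split : c + t * F₁ ≤ t * d + length (neighbours G y) * F₁
    split = length-concatMap-split (ball? G x i) neighboursInLayer
      (λ w _ → neighboursInLayer-≤-degree w) neighboursInLayer-≤-F₁ (neighbours G y)

lemma24 : (d k : ℕ) → 2 ≤ d → 2 ≤ k → {n : ℕ} → (G : Graph n) → Regular G d →
    (f : ℕ → ℕ) →
    (∀ i → 1 ≤ i → i ≤ k → 1 ≤ f i) →
    (∀ i → 1 ≤ i → i ≤ k → ∀ x y → ¬ Ball G x (i ∸ 1) y →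
      AtMost (f i) (λ w → Sphere G x i w × Graph.Adj G y w)) →
    (x : Fin n) →
    Σ ℕ λ m → m ≤ d * (f (k ∸ 1) + f k) + 1 ×
      Σ (Fin n → Fin m) λ c →
        ∀ y z → Sphere G x k y → Sphere G x k z → y ≢ z → c y ≡ c z → DistGe3 G y z
lemma24 d (suc (suc i)) _ _ G regular f _ layer-bound x =
  suc D , ≤-reflexive (+-comm 1 D) , colouring ,
  λ y z y∈L z∈L y≢z same near →
    colouring-proper (Ball-sym G) conflicts-length near⇒conflict y∈L z∈L y≢z near same
  where
  D : ℕ
  D = d * (f (suc i) + f (suc (suc i)))
  open Conflicts G regular x (suc i)
    (layer-bound (suc i) (s≤s z≤n) (n≤1+n (suc i)) x) (layer-bound (suc (suc i)) (s≤s z≤n) ≤-refl x)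
  open GreedyColouring D conflicts
lemma24 _ 1 _ (s≤s ()) _ _ _ _ _ _
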